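{- Let $G=(V,E)$ be a graph. The map $f:2^V\to\mathbb{Z}$, $A\mapsto r^*(\delta(A))-1$, is submodular and increasing. That is, $f(A\cup B)+f(A\cap B)\le f(A)+f(B)$ for all $A,B\subseteq V$, and $f(A)\le f(B)$ whenever $A\subseteq B\subseteq V$.
   Context: Graphs are finite and undirected and may have parallel edges and loops. $r^*$ denotes the rank function of the bond (cographic) matroid of $G$, the dual of the cycle matroid of $G$, on ground set $E$. For $A\subseteq V$, $\delta(A)$ is the set of edges incident to at least one vertex of $A$. -}

module Defs where

open import Data.Nat as ℕ using (ℕ; zero; suc; _≤_)
open import Data.Nat.Properties using (_<?_)
open import Data.Fin using (Fin; zero; suc; toℕ; fromℕ<)
open import Data.Fin.Subset using (Subset; _∈_; _∉_; _⊆_; _∪_; ⁅_⁆; ∣_∣)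
open import Data.Fin.Subset.Properties using (_∈?_)
open import Data.Vec using (tabulate)
open import Data.Bool using (_∨_)
open import Data.Product using (Σ; _×_; _,_; proj₁; proj₂)
open import Data.Sum using (_⊎_)
open import Relation.Nullary using (¬_; yes; no)
open import Relation.Nullary.Decidable using (⌊_⌋)
open import Relation.Binary.PropositionalEquality using (_≡_)
open import Function.Definitions using (Injective)

-- A finite multigraph (parallel edges and loops allowed) with vertex set
-- Fin n and edge set Fin m: each edge is assigned its two endpoints.
Graph : ℕ → ℕ → Set
Graph n m = Fin m → Fin n × Fin n

Joins : ∀ {n m} → Graph n m → Fin m → Fin n → Fin n → Set
Joins G e u v = (G e ≡ (u , v)) ⊎ (G e ≡ (v , u))

sucMod : ∀ {k} → Fin (suc k) → Fin (suc k)
sucMod {k} i with toℕ i <? k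
... | yes p = suc (fromℕ< p)
... | no _  = zero

-- F contains a cycle: distinct vertices v_0..v_k and distinct edges
-- e_0..e_k in F, with e_i joining v_i and v_{i+1 mod (k+1)}.
-- (k = 0: a loop; k = 1: two parallel edges.)
HasCycle : ∀ {n m} → Graph n m → Subset m → Set
HasCycle {n} {m} G F =
  Σ ℕ λ k → Σ (Fin (suc k) → Fin n) λ vs → Σ (Fin (suc k) → Fin m) λ es →
    Injective _≡_ _≡_ vs × Injective _≡_ _≡_ es ×
    (∀ i → es i ∈ F) × (∀ i → Joins G (es i) (vs i) (vs (sucMod i)))

Acyclic : ∀ {n m} → Graph n m → Subset m → Set
Acyclic G F = ¬ HasCycle G F

IsBase : ∀ {n m} → Graph n m → Subset m → Set
IsBase G B = Acyclic G B × (∀ e → e ∉ B → HasCycle G (⁅ e ⁆ ∪ B))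

-- independent sets of the dual (bond) matroid M*(G):
-- sets contained in the complement of some basis of M(G)
CoIndep : ∀ {n m} → Graph n m → Subset m → Set
CoIndep {n} {m} G I = Σ (Subset m) λ B → IsBase G B × (∀ e → e ∈ I → e ∉ B)

IsBondRank : ∀ {n m} → Graph n m → Subset m → ℕ → Set
IsBondRank {n} {m} G X k =
  (Σ (Subset m) λ I → I ⊆ X × CoIndep G I × ∣ I ∣ ≡ k) ×
  (∀ I → I ⊆ X → CoIndep G I → ∣ I ∣ ≤ k)

δ : ∀ {n m} → Graph n m → Subset n → Subset m
δ G A = tabulate λ e → ⌊ proj₁ (G e) ∈? A ⌋ ∨ ⌊ proj₂ (G e) ∈? A ⌋

{-# OPTIONS --safe #-}
module Submission where

-- The bond rank r* is the rank function of a matroid, hence monotone and submodular, and δ is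
-- monotone with δ(A ∪ B) ⊆ δ(A) ∪ δ(B) and δ(A ∩ B) ⊆ δ(A) ∩ δ(B), so f inherits both properties.
-- The substance is the augmentation property of coindependent sets, derived from the definitions
-- through walks: an edge e lies on a cycle of S exactly when S − e contains a walk between the
-- ends of e, and an acyclic J whose edges are all joined by walks in F has |J| ≤ |F| (trade edges
-- of F for edges of J one at a time). If no edge of K − I extends the coindependent set I, take
-- bases Bᴵ, Bᴷ disjoint from I, K; then K − I ⊆ Bᴵ and Bᴷ − I is spanned by Bᴵ − K, and counting
-- gives |K| ≤ |I|.

open import Defs
open import Data.Nat using (ℕ)

module Subsets where

  open import Data.Nat using (suc; _+_; _≤_)
  open import Data.Nat.Properties
  open import Data.Fin using (Fin)
  open import Data.Vec using ([]; _∷_; here; there)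
  open import Data.Fin.Subset
  open import Data.Fin.Subset.Properties
  open import Data.Product using (_,_)
  open import Data.Sum using (inj₁; inj₂)
  open import Relation.Binary.PropositionalEquality
  open import Relation.Nullary using (yes; no; contradiction)

  x∈p─q⇒x∉q : ∀ {n} {x : Fin n} {p q : Subset n} → x ∈ p ─ q → x ∉ q
  x∈p─q⇒x∉q {p = _ ∷ _} {outside ∷ _} here ()
  x∈p─q⇒x∉q {p = _ ∷ _} {_ ∷ _} (there x∈p─q) (there x∈q) = x∈p─q⇒x∉q x∈p─q x∈q

  x∈p-y⇒x≢y : ∀ {n} {x y : Fin n} {p : Subset n} → x ∈ p - y → x ≢ y
  x∈p-y⇒x≢y x∈p-y = x∉⁅y⁆⇒x≢y (x∈p─q⇒x∉q x∈p-y)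

  x∈⁅y⁆∪p∧x≢y⇒x∈p : ∀ {n} {x y : Fin n} {p : Subset n} → x ∈ ⁅ y ⁆ ∪ p → x ≢ y → x ∈ p
  x∈⁅y⁆∪p∧x≢y⇒x∈p {x = x} {y} {p} x∈ x≢y with x∈p∪q⁻ ⁅ y ⁆ p x∈
  ... | inj₁ x∈⁅y⁆ = contradiction (x∈⁅y⁆⇒x≡y y x∈⁅y⁆) x≢y
  ... | inj₂ x∈p = x∈p

  x∈[⁅y⁆∪p]─q∧x≢y⇒x∈p─q : ∀ {n} {x y : Fin n} {p q : Subset n} → x ∈ (⁅ y ⁆ ∪ p) ─ q → x ≢ y → x ∈ p ─ q
  x∈[⁅y⁆∪p]─q∧x≢y⇒x∈p─q {p = p} {q} x∈ x≢y =
    x∈p∧x∉q⇒x∈p─q (x∈⁅y⁆∪p∧x≢y⇒x∈p (p─q⊆p _ q x∈) x≢y) (x∈p─q⇒x∉q x∈)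

  ∣p∣+∣q∣≡∣p∪q∣+∣p∩q∣ : ∀ {n} (p q : Subset n) → ∣ p ∣ + ∣ q ∣ ≡ ∣ p ∪ q ∣ + ∣ p ∩ q ∣
  ∣p∣+∣q∣≡∣p∪q∣+∣p∩q∣ [] [] = refl
  ∣p∣+∣q∣≡∣p∪q∣+∣p∩q∣ (inside ∷ p) (inside ∷ q) =
    cong suc (trans (+-suc ∣ p ∣ ∣ q ∣) (trans (cong suc (∣p∣+∣q∣≡∣p∪q∣+∣p∩q∣ p q)) (sym (+-suc _ _))))
  ∣p∣+∣q∣≡∣p∪q∣+∣p∩q∣ (inside ∷ p) (outside ∷ q) = cong suc (∣p∣+∣q∣≡∣p∪q∣+∣p∩q∣ p q)
  ∣p∣+∣q∣≡∣p∪q∣+∣p∩q∣ (outside ∷ p) (inside ∷ q) =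
    trans (+-suc ∣ p ∣ ∣ q ∣) (cong suc (∣p∣+∣q∣≡∣p∪q∣+∣p∩q∣ p q))
  ∣p∣+∣q∣≡∣p∪q∣+∣p∩q∣ (outside ∷ p) (outside ∷ q) = ∣p∣+∣q∣≡∣p∪q∣+∣p∩q∣ p q

  ∣p∪q∣≤∣p∣+∣q∣ : ∀ {n} (p q : Subset n) → ∣ p ∪ q ∣ ≤ ∣ p ∣ + ∣ q ∣
  ∣p∪q∣≤∣p∣+∣q∣ p q = subst (∣ p ∪ q ∣ ≤_) (sym (∣p∣+∣q∣≡∣p∪q∣+∣p∩q∣ p q)) (m≤m+n _ _)

  Empty[p∩q]⇒∣p∪q∣≡∣p∣+∣q∣ : ∀ {n} (p q : Subset n) → Empty (p ∩ q) → ∣ p ∪ q ∣ ≡ ∣ p ∣ + ∣ q ∣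
  Empty[p∩q]⇒∣p∪q∣≡∣p∣+∣q∣ {n} p q empty = begin
    ∣ p ∪ q ∣                ≡⟨ +-identityʳ _ ⟨
    ∣ p ∪ q ∣ + 0            ≡⟨ cong (∣ p ∪ q ∣ +_) (∣⊥∣≡0 n) ⟨
    ∣ p ∪ q ∣ + ∣ ⊥ {n} ∣     ≡⟨ cong (λ r → ∣ p ∪ q ∣ + ∣ r ∣) (Empty-unique empty) ⟨
    ∣ p ∪ q ∣ + ∣ p ∩ q ∣     ≡⟨ ∣p∣+∣q∣≡∣p∪q∣+∣p∩q∣ p q ⟨
    ∣ p ∣ + ∣ q ∣             ∎
    where open ≡-Reasoning

  x∉p⇒∣⁅x⁆∪p∣≡1+∣p∣ : ∀ {n} {x : Fin n} {p} → x ∉ p → ∣ ⁅ x ⁆ ∪ p ∣ ≡ suc ∣ p ∣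
  x∉p⇒∣⁅x⁆∪p∣≡1+∣p∣ {x = x} {p} x∉p = begin
    ∣ ⁅ x ⁆ ∪ p ∣     ≡⟨ Empty[p∩q]⇒∣p∪q∣≡∣p∣+∣q∣ ⁅ x ⁆ p ⁅x⁆∩p-empty ⟩
    ∣ ⁅ x ⁆ ∣ + ∣ p ∣  ≡⟨ cong (_+ ∣ p ∣) (∣⁅x⁆∣≡1 x) ⟩
    suc ∣ p ∣         ∎
    where
    open ≡-Reasoning
    ⁅x⁆∩p-empty : Empty (⁅ x ⁆ ∩ p)
    ⁅x⁆∩p-empty (y , y∈) with x∈p∩q⁻ ⁅ x ⁆ p y∈
    ... | y∈⁅x⁆ , y∈p = x∉p (subst (_∈ p) (x∈⁅y⁆⇒x≡y x y∈⁅x⁆) y∈p)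

  ∣⁅x⁆∪p∣≤1+∣p∣ : ∀ {n} (x : Fin n) p → ∣ ⁅ x ⁆ ∪ p ∣ ≤ suc ∣ p ∣
  ∣⁅x⁆∪p∣≤1+∣p∣ x p = subst (∣ ⁅ x ⁆ ∪ p ∣ ≤_) (cong (_+ ∣ p ∣) (∣⁅x⁆∣≡1 x)) (∣p∪q∣≤∣p∣+∣q∣ ⁅ x ⁆ p)

  ∣p∣≡∣p∩q∣+∣p─q∣ : ∀ {n} (p q : Subset n) → ∣ p ∣ ≡ ∣ p ∩ q ∣ + ∣ p ─ q ∣
  ∣p∣≡∣p∩q∣+∣p─q∣ [] [] = refl
  ∣p∣≡∣p∩q∣+∣p─q∣ (inside ∷ p) (inside ∷ q) = cong suc (∣p∣≡∣p∩q∣+∣p─q∣ p q)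
  ∣p∣≡∣p∩q∣+∣p─q∣ (inside ∷ p) (outside ∷ q) = trans (cong suc (∣p∣≡∣p∩q∣+∣p─q∣ p q)) (sym (+-suc _ _))
  ∣p∣≡∣p∩q∣+∣p─q∣ (outside ∷ p) (inside ∷ q) = ∣p∣≡∣p∩q∣+∣p─q∣ p q
  ∣p∣≡∣p∩q∣+∣p─q∣ (outside ∷ p) (outside ∷ q) = ∣p∣≡∣p∩q∣+∣p─q∣ p q

  ∣p─q∣≤∣q─p∣⇒∣p∣≤∣q∣ : ∀ {n} (p q : Subset n) → ∣ p ─ q ∣ ≤ ∣ q ─ p ∣ → ∣ p ∣ ≤ ∣ q ∣
  ∣p─q∣≤∣q─p∣⇒∣p∣≤∣q∣ p q ∣p─q∣≤∣q─p∣ = begin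
    ∣ p ∣                  ≡⟨ ∣p∣≡∣p∩q∣+∣p─q∣ p q ⟩
    ∣ p ∩ q ∣ + ∣ p ─ q ∣  ≤⟨ +-monoʳ-≤ ∣ p ∩ q ∣ ∣p─q∣≤∣q─p∣ ⟩
    ∣ p ∩ q ∣ + ∣ q ─ p ∣  ≡⟨ cong (λ r → ∣ r ∣ + ∣ q ─ p ∣) (∩-comm p q) ⟩
    ∣ q ∩ p ∣ + ∣ q ─ p ∣  ≡⟨ ∣p∣≡∣p∩q∣+∣p─q∣ q p ⟨
    ∣ q ∣                  ∎
    where open ≤-Reasoning

  p⊆q⇒∣q∣≤∣p∣⇒q⊆p : ∀ {n} {p q : Subset n} → p ⊆ q → ∣ q ∣ ≤ ∣ p ∣ → q ⊆ p
  p⊆q⇒∣q∣≤∣p∣⇒q⊆p {p = p} p⊆q ∣q∣≤∣p∣ {x} x∈q with x ∈? p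
  ... | yes x∈p = x∈p
  ... | no x∉p = contradiction ∣q∣≤∣p∣ (<⇒≱ (p⊂q⇒∣p∣<∣q∣ (p⊆q , x , x∈q , x∉p)))

module CyclicSuccessor where

  open import Data.Nat as ℕ using (zero; suc; _+_; _*_; _<_; z≤n; s≤s; s≤s⁻¹)
  open import Data.Nat.Properties
  open import Data.Nat.DivMod
    using (_%_; _/_; m<n⇒m%n≡m; n%n≡0; m%n%n≡m%n; %-distribˡ-+; [m+n]%n≡m%n; m≡m%n+[m/n]*n)
  open import Data.Fin using (Fin; zero; suc; toℕ; fromℕ; inject₁; lower₁; punchIn)
  open import Data.Fin.Properties
    using (toℕ-injective; toℕ-fromℕ<; toℕ<n; toℕ-fromℕ; toℕ-inject₁; inject₁-lower₁)
  open import Data.Product using (∃; _,_)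
  open import Data.Sum using (_⊎_; inj₁; inj₂)
  open import Relation.Binary.PropositionalEquality
  open import Relation.Nullary using (yes; no; contradiction)

  inject₁-or-fromℕ : ∀ {k} (i : Fin (suc k)) → (∃ λ j → inject₁ j ≡ i) ⊎ fromℕ k ≡ i
  inject₁-or-fromℕ {k} i with k ℕ.≟ toℕ i
  ... | no k≢i = inj₁ (lower₁ i k≢i , inject₁-lower₁ i k≢i)
  ... | yes k≡i = inj₂ (toℕ-injective (trans (toℕ-fromℕ k) k≡i))

  punchIn-fromℕ : ∀ {k} (j : Fin k) → punchIn (fromℕ k) j ≡ inject₁ j
  punchIn-fromℕ zero = refl
  punchIn-fromℕ (suc j) = cong suc (punchIn-fromℕ j)

  [m%n+o]%n≡[m+o]%n : ∀ m o n .{{_ : ℕ.NonZero n}} → (m % n + o) % n ≡ (m + o) % n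
  [m%n+o]%n≡[m+o]%n m o n = begin
    (m % n + o) % n          ≡⟨ %-distribˡ-+ (m % n) o n ⟩
    (m % n % n + o % n) % n  ≡⟨ cong (λ x → (x + o % n) % n) (m%n%n≡m%n m n) ⟩
    (m % n + o % n) % n      ≡⟨ %-distribˡ-+ m o n ⟨
    (m + o) % n              ∎
    where open ≡-Reasoning

  -- (m + c) % n = m would make c a multiple of n, impossible for 0 < c < n.
  [m+c]%n≢m : ∀ {m c n} .{{_ : ℕ.NonZero n}} → 0 < c → c < n → (m + c) % n ≢ m
  [m+c]%n≢m {m} {c} {n} 0<c c<n eq with (m + c) / n | c≡q*n
    where
    c≡q*n : c ≡ ((m + c) / n) * n
    c≡q*n = +-cancelˡ-≡ m c _ (trans (m≡m%n+[m/n]*n (m + c) n) (cong (_+ ((m + c) / n) * n) eq))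
  ... | zero | c≡0 = contradiction c≡0 (>⇒≢ 0<c)
  ... | suc q | c≡n+q*n = contradiction (≤-trans (m≤m+n n (q * n)) (≤-reflexive (sym c≡n+q*n))) (<⇒≱ c<n)

  toℕ-sucMod : ∀ {k} (i : Fin (suc k)) → toℕ (sucMod i) ≡ suc (toℕ i) % suc k
  toℕ-sucMod {k} i with toℕ i <? k
  ... | yes i<k = trans (cong suc (toℕ-fromℕ< i<k)) (sym (m<n⇒m%n≡m (s≤s i<k)))
  ... | no i≮k = begin
    0                    ≡⟨ n%n≡0 (suc k) ⟨
    suc k % suc k        ≡⟨ cong (λ j → suc j % suc k) (≤-antisym (≮⇒≥ i≮k) (s≤s⁻¹ (toℕ<n i))) ⟩
    suc (toℕ i) % suc k  ∎
    where open ≡-Reasoning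

  sucMod-inject₁ : ∀ {k} (j : Fin k) → sucMod (inject₁ j) ≡ suc j
  sucMod-inject₁ {k} j = toℕ-injective (begin
    toℕ (sucMod (inject₁ j))      ≡⟨ toℕ-sucMod (inject₁ j) ⟩
    suc (toℕ (inject₁ j)) % suc k ≡⟨ cong (λ i → suc i % suc k) (toℕ-inject₁ j) ⟩
    suc (toℕ j) % suc k           ≡⟨ m<n⇒m%n≡m (s≤s (toℕ<n j)) ⟩
    suc (toℕ j)                   ∎)
    where open ≡-Reasoning

  sucMod-fromℕ : ∀ k → sucMod (fromℕ k) ≡ zero
  sucMod-fromℕ k = toℕ-injective (begin
    toℕ (sucMod (fromℕ k))   ≡⟨ toℕ-sucMod (fromℕ k) ⟩
    suc (toℕ (fromℕ k)) % suc k ≡⟨ cong (λ i → suc i % suc k) (toℕ-fromℕ k) ⟩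
    suc k % suc k            ≡⟨ n%n≡0 (suc k) ⟩
    0                        ∎)
    where open ≡-Reasoning

  sucMod^ : ∀ {k} → ℕ → Fin (suc k) → Fin (suc k)
  sucMod^ zero i = i
  sucMod^ (suc t) i = sucMod^ t (sucMod i)

  toℕ-sucMod^ : ∀ {k} t (i : Fin (suc k)) → toℕ (sucMod^ t i) ≡ (toℕ i + t) % suc k
  toℕ-sucMod^ {k} zero i = sym (trans (cong (_% suc k) (+-identityʳ (toℕ i))) (m<n⇒m%n≡m (toℕ<n i)))
  toℕ-sucMod^ {k} (suc t) i = begin
    toℕ (sucMod^ t (sucMod i))        ≡⟨ toℕ-sucMod^ t (sucMod i) ⟩
    (toℕ (sucMod i) + t) % suc k      ≡⟨ cong (λ x → (x + t) % suc k) (toℕ-sucMod i) ⟩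
    (suc (toℕ i) % suc k + t) % suc k ≡⟨ [m%n+o]%n≡[m+o]%n (suc (toℕ i)) t (suc k) ⟩
    (suc (toℕ i) + t) % suc k         ≡⟨ cong (_% suc k) (+-suc (toℕ i) t) ⟨
    (toℕ i + suc t) % suc k           ∎
    where open ≡-Reasoning

  sucMod^-period : ∀ {k} (i : Fin (suc k)) → sucMod^ (suc k) i ≡ i
  sucMod^-period {k} i = toℕ-injective (begin
    toℕ (sucMod^ (suc k) i)    ≡⟨ toℕ-sucMod^ (suc k) i ⟩
    (toℕ i + suc k) % suc k    ≡⟨ [m+n]%n≡m%n (toℕ i) (suc k) ⟩
    toℕ i % suc k              ≡⟨ m<n⇒m%n≡m (toℕ<n i) ⟩
    toℕ i                      ∎)
    where open ≡-Reasoning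

  sucMod^-aperiodic : ∀ {k t} (i : Fin (suc k)) → t < k → sucMod^ (suc t) i ≢ i
  sucMod^-aperiodic {k} {t} i t<k eq =
    [m+c]%n≢m (s≤s z≤n) (s≤s t<k) (trans (sym (toℕ-sucMod^ (suc t) i)) (cong toℕ eq))
module Walks {n m : ℕ} (G : Graph n m) where

  open import Data.Nat using (suc)
  open import Data.Fin using (Fin; zero; suc; fromℕ; inject₁)
  open import Data.Fin.Properties using (any?) renaming (_≟_ to _≟ᶠ_)
  open import Data.Product using (Σ-syntax; _×_; _,_; proj₁; proj₂)
  open import Data.Sum using (_⊎_; inj₁; inj₂)
  open import Data.Unit using (⊤; tt)
  open import Data.Empty using (⊥; ⊥-elim)
  open import Relation.Binary.PropositionalEquality
  open import Relation.Nullary using (¬_; yes; no; contradiction)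
  open import Level using (0ℓ)
  open import Relation.Unary using (Pred; Decidable; _⊆_; _∩_)
  open import Function using (_∘_)

  data Walk (P : Pred (Fin m) 0ℓ) : Fin n → Fin n → Set where
    nil  : ∀ {v} → Walk P v v
    cons : ∀ {u w v} e → P e → Joins G e u w → Walk P w v → Walk P u v

  Spans : Pred (Fin m) 0ℓ → Pred (Fin m) 0ℓ
  Spans P g = Walk P (proj₁ (G g)) (proj₂ (G g))

  joins-sym : ∀ {e u v} → Joins G e u v → Joins G e v u
  joins-sym (inj₁ eq) = inj₂ eq
  joins-sym (inj₂ eq) = inj₁ eq

  joins-endpoint : ∀ {e u x a b} → Joins G e u x → Joins G e a b → u ≡ a ⊎ u ≡ b
  joins-endpoint (inj₁ p) (inj₁ q) = inj₁ (cong proj₁ (trans (sym p) q))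
  joins-endpoint (inj₁ p) (inj₂ q) = inj₂ (cong proj₁ (trans (sym p) q))
  joins-endpoint (inj₂ p) (inj₁ q) = inj₂ (cong proj₂ (trans (sym p) q))
  joins-endpoint (inj₂ p) (inj₂ q) = inj₁ (cong proj₂ (trans (sym p) q))

  mapᵂ : ∀ {P Q} → P ⊆ Q → ∀ {u v} → Walk P u v → Walk Q u v
  mapᵂ P⊆Q nil = nil
  mapᵂ P⊆Q (cons e p j w) = cons e (P⊆Q p) j (mapᵂ P⊆Q w)

  module _ {P : Pred (Fin m) 0ℓ} where

    infixr 5 _++ᵂ_

    _++ᵂ_ : ∀ {u w v} → Walk P u w → Walk P w v → Walk P u v
    nil ++ᵂ w′ = w′
    cons e p j w ++ᵂ w′ = cons e p j (w ++ᵂ w′)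

    reverseᵂ : ∀ {u v} → Walk P u v → Walk P v u
    reverseᵂ nil = nil
    reverseᵂ (cons e p j w) = reverseᵂ w ++ᵂ cons e p (joins-sym j) nil

    spans-self : ∀ {g} → P g → Spans P g
    spans-self p = cons _ p (inj₁ refl) nil

    walk⇒spans : ∀ {g x y} → Joins G g x y → Walk P x y → Spans P g
    walk⇒spans (inj₁ eq) w rewrite eq = w
    walk⇒spans (inj₂ eq) w rewrite eq = reverseᵂ w

    spans⇒walk : ∀ {g x y} → Joins G g x y → Spans P g → Walk P x y
    spans⇒walk (inj₁ eq) w rewrite eq = w
    spans⇒walk (inj₂ eq) w rewrite eq = reverseᵂ w

  bindᵂ : ∀ {P Q u v} → Walk P u v → (∀ {h} → P h → Spans Q h) → Walk Q u v
  bindᵂ nil f = nil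
  bindᵂ (cons e p j w) f = spans⇒walk j (f p) ++ᵂ bindᵂ w f

  module _ {P : Pred (Fin m) 0ℓ} where

    lengthᵂ : ∀ {u v} → Walk P u v → ℕ
    lengthᵂ nil = 0
    lengthᵂ (cons e p j w) = suc (lengthᵂ w)

    verticesᵂ : ∀ {u v} (w : Walk P u v) → Fin (suc (lengthᵂ w)) → Fin n
    verticesᵂ {v = v} nil zero = v
    verticesᵂ (cons {u} e p j w) zero = u
    verticesᵂ (cons e p j w) (suc i) = verticesᵂ w i

    edgesᵂ : ∀ {u v} (w : Walk P u v) → Fin (lengthᵂ w) → Fin m
    edgesᵂ (cons e p j w) zero = e
    edgesᵂ (cons e p j w) (suc i) = edgesᵂ w i

    verticesᵂ-first : ∀ {u v} (w : Walk P u v) → verticesᵂ w zero ≡ u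
    verticesᵂ-first nil = refl
    verticesᵂ-first (cons e p j w) = refl

    verticesᵂ-last : ∀ {u v} (w : Walk P u v) → verticesᵂ w (fromℕ (lengthᵂ w)) ≡ v
    verticesᵂ-last nil = refl
    verticesᵂ-last (cons e p j w) = verticesᵂ-last w

    edgesᵂ-joins : ∀ {u v} (w : Walk P u v) i →
      Joins G (edgesᵂ w i) (verticesᵂ w (inject₁ i)) (verticesᵂ w (suc i))
    edgesᵂ-joins (cons e p j w) zero = subst (Joins G e _) (sym (verticesᵂ-first w)) j
    edgesᵂ-joins (cons e p j w) (suc i) = edgesᵂ-joins w i

    edgesᵂ-satisfy : ∀ {u v} (w : Walk P u v) i → P (edgesᵂ w i)
    edgesᵂ-satisfy (cons e p j w) zero = p
    edgesᵂ-satisfy (cons e p j w) (suc i) = edgesᵂ-satisfy w i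

    Simple : ∀ {u v} → Walk P u v → Set
    Simple nil = ⊤
    Simple (cons {u} e p j w) = (∀ i → verticesᵂ w i ≢ u) × Simple w

    verticesᵂ-injective : ∀ {u v} (w : Walk P u v) → Simple w → ∀ {i i′} →
      verticesᵂ w i ≡ verticesᵂ w i′ → i ≡ i′
    verticesᵂ-injective nil _ {zero} {zero} _ = refl
    verticesᵂ-injective (cons e p j w) _ {zero} {zero} _ = refl
    verticesᵂ-injective (cons e p j w) (fresh , _) {zero} {suc i′} eq = contradiction (sym eq) (fresh i′)
    verticesᵂ-injective (cons e p j w) (fresh , _) {suc i} {zero} eq = contradiction eq (fresh i)
    verticesᵂ-injective (cons e p j w) (_ , simple) {suc i} {suc i′} eq =
      cong suc (verticesᵂ-injective w simple eq)

    ¬rejoin : ∀ {u x v e} (w : Walk P x v) {l} → (∀ i → verticesᵂ w i ≢ u) →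
      Joins G e u x → Joins G e (verticesᵂ w (inject₁ l)) (verticesᵂ w (suc l)) → ⊥
    ¬rejoin w fresh j j′ with joins-endpoint j j′
    ... | inj₁ eq = fresh _ (sym eq)
    ... | inj₂ eq = fresh _ (sym eq)

    edgesᵂ-injective : ∀ {u v} (w : Walk P u v) → Simple w → ∀ {i i′} →
      edgesᵂ w i ≡ edgesᵂ w i′ → i ≡ i′
    edgesᵂ-injective (cons e p j w) _ {zero} {zero} _ = refl
    edgesᵂ-injective (cons e p j w) (fresh , _) {zero} {suc i′} eq =
      ⊥-elim (¬rejoin w fresh j (subst (λ h → Joins G h _ _) (sym eq) (edgesᵂ-joins w i′)))
    edgesᵂ-injective (cons e p j w) (fresh , _) {suc i} {zero} eq =
      ⊥-elim (¬rejoin w fresh j (subst (λ h → Joins G h _ _) eq (edgesᵂ-joins w i)))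
    edgesᵂ-injective (cons e p j w) (_ , simple) {suc i} {suc i′} eq =
      cong suc (edgesᵂ-injective w simple eq)

    suffixᵂ : ∀ {x y} (w : Walk P x y) i → Simple w → Σ[ w′ ∈ Walk P (verticesᵂ w i) y ] Simple w′
    suffixᵂ nil zero _ = nil , tt
    suffixᵂ (cons e p j w) zero simple = cons e p j w , simple
    suffixᵂ (cons e p j w) (suc i) (_ , simple) = suffixᵂ w i simple

    loop-erase : ∀ {u v} → Walk P u v → Σ[ w ∈ Walk P u v ] Simple w
    loop-erase nil = nil , tt
    loop-erase {u} {v} (cons e p j w) with loop-erase w
    ... | w′ , simple with any? (λ i → verticesᵂ w′ i ≟ᶠ u)
    ... | yes (i , eq) = subst (λ x → Σ[ w ∈ Walk P x v ] Simple w) eq (suffixᵂ w′ i simple)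
    ... | no ¬revisit = cons e p j w′ , (λ i eq → ¬revisit (i , eq)) , simple

    avoid-edge-at : ∀ {x y f p q} (w : Walk P x y) → (∀ i → verticesᵂ w i ≢ p) →
      Joins G f p q → Walk (P ∩ (_≢ f)) x y
    avoid-edge-at nil _ _ = nil
    avoid-edge-at (cons e pe je w) fresh jf = cons e (pe , e≢f) je (avoid-edge-at w (fresh ∘ suc) jf)
      where
      e≢f : e ≢ _
      e≢f refl with joins-endpoint jf je
      ... | inj₁ eq = fresh zero (sym eq)
      ... | inj₂ eq = fresh (suc zero) (trans (verticesᵂ-first w) (sym eq))

    within-or-first-exit : ∀ {Q} → Decidable Q → ∀ {x y} (w : Walk P x y) → Simple w →
      Walk (P ∩ Q) x y ⊎
      Σ[ f ∈ Fin m ] Σ[ p ∈ Fin n ] Σ[ q ∈ Fin n ]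
        P f × ¬ Q f × Joins G f p q × Walk (P ∩ Q) x p × Walk (P ∩ (_≢ f)) q y
    within-or-first-exit Q? nil _ = inj₁ nil
    within-or-first-exit Q? (cons {u} {w₀} e pe je w) (fresh , simple) with Q? e
    ... | no ¬qe = inj₂ (e , u , w₀ , pe , ¬qe , je , nil , avoid-edge-at w fresh je)
    ... | yes qe with within-or-first-exit Q? w simple
    ... | inj₁ inside = inj₁ (cons e (pe , qe) je inside)
    ... | inj₂ (f , p , q , pf , ¬qf , jf , before , after) =
          inj₂ (f , p , q , pf , ¬qf , jf , cons e (pe , qe) je before , after)

module Cycles {n m : ℕ} (G : Graph n m) where

  open import Data.Nat using (zero; suc; _<_; z≤n; s≤s)
  open import Data.Fin using (Fin; fromℕ; inject₁)
  open import Data.Fin.Subset using (_∈_; _⊆_; _─_; _-_; ⁅_⁆)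
  open import Data.Fin.Subset.Properties using (x∈p∧x∉q⇒x∈p─q; x∈⁅y⁆⇒x≡y; _∈?_)
  open import Data.Fin.Properties using (any?)
  open import Data.Vec.Functional using (insertAt)
  open import Data.Vec.Functional.Properties using (insertAt-lookup; insertAt-punchIn)
  open import Data.Product using (Σ-syntax; _×_; _,_; proj₁; proj₂)
  open import Data.Sum using (_⊎_; inj₁; inj₂)
  open import Function.Definitions using (Injective)
  open import Relation.Binary.PropositionalEquality
  open import Relation.Nullary using (yes; no; contradiction)
  open import Level using (0ℓ)
  open import Relation.Unary using (Pred; _∩_)
  open import Function using (_∘_)
  open Walks G
  open CyclicSuccessor

  HasCycle-mono : ∀ {S T} → S ⊆ T → HasCycle G S → HasCycle G T
  HasCycle-mono S⊆T (k , vs , es , vs-inj , es-inj , es∈S , joins) =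
    k , vs , es , vs-inj , es-inj , S⊆T ∘ es∈S , joins

  OnCycle : ∀ {k} → (Fin (suc k) → Fin m) → Pred (Fin m) 0ℓ
  OnCycle es h = Σ[ i ∈ _ ] es i ≡ h

  module _ {k} (vs : Fin (suc k) → Fin n) (es : Fin (suc k) → Fin m)
           (joins : ∀ i → Joins G (es i) (vs i) (vs (sucMod i))) where

    trail : ∀ t i → Walk (λ h → Σ[ l ∈ _ ] l < t × es (sucMod^ l i) ≡ h) (vs i) (vs (sucMod^ t i))
    trail zero i = nil
    trail (suc t) i = cons (es i) (0 , s≤s z≤n , refl) (joins i)
      (mapᵂ (λ (l , l<t , eq) → suc l , s≤s l<t , eq) (trail t (sucMod i)))

    -- Go once around the cycle, starting just after edge j and stopping just before it.
    around : Injective _≡_ _≡_ es → ∀ j → Spans (OnCycle es ∩ (_≢ es j)) (es j)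
    around es-inj j = walk⇒spans (joins-sym (joins j))
      (subst (Walk _ _) (cong vs (sucMod^-period j)) (mapᵂ other-edge (trail k (sucMod j))))
      where
      other-edge : ∀ {h} → Σ[ l ∈ _ ] l < k × es (sucMod^ (suc l) j) ≡ h → (OnCycle es ∩ (_≢ es j)) h
      other-edge (l , l<k , refl) = (_ , refl) , λ eq → sucMod^-aperiodic j l<k (es-inj eq)

  cycle-meets∨avoids : ∀ {S} K → HasCycle G S →
    (Σ[ e ∈ Fin m ] e ∈ S × e ∈ K × Spans ((_∈ S) ∩ (_≢ e)) e) ⊎ HasCycle G (S ─ K)
  cycle-meets∨avoids K (k , vs , es , vs-inj , es-inj , es∈S , joins) with any? (λ i → es i ∈? K)
  ... | yes (j , esⱼ∈K) =
        inj₁ (es j , es∈S j , esⱼ∈K ,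
              mapᵂ (λ { ((i , refl) , ≢esⱼ) → es∈S i , ≢esⱼ }) (around vs es joins es-inj j))
  ... | no ∄ = inj₂ (k , vs , es , vs-inj , es-inj ,
                     (λ i → x∈p∧x∉q⇒x∈p─q (es∈S i) (λ esᵢ∈K → ∄ (i , esᵢ∈K))) , joins)

  cycle-avoids∨spans : ∀ {S} g → HasCycle G S → HasCycle G (S - g) ⊎ Spans ((_∈ S) ∩ (_≢ g)) g
  cycle-avoids∨spans {S} g cycle with cycle-meets∨avoids ⁅ g ⁆ cycle
  ... | inj₁ (e , _ , e∈⁅g⁆ , e-spanned) =
        inj₂ (subst (λ e → Spans ((_∈ S) ∩ (_≢ e)) e) (x∈⁅y⁆⇒x≡y g e∈⁅g⁆) e-spanned)
  ... | inj₂ cycle′ = inj₁ cycle′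

  simple-spans⇒cycle : ∀ {S e} → e ∈ S → (w : Spans ((_∈ S) ∩ (_≢ e)) e) → Simple w → HasCycle G S
  simple-spans⇒cycle {S} {e} e∈S w simple =
    lengthᵂ w , verticesᵂ w , es , verticesᵂ-injective w simple , es-injective , es∈S , es-joins
    where
    k = lengthᵂ w
    es : Fin (suc k) → Fin m
    es = insertAt (edgesᵂ w) (fromℕ k) e
    es-inject₁ : ∀ j → es (inject₁ j) ≡ edgesᵂ w j
    es-inject₁ j =
      subst (λ i → es i ≡ edgesᵂ w j) (punchIn-fromℕ j) (insertAt-punchIn (edgesᵂ w) (fromℕ k) e j)
    es-fromℕ : es (fromℕ k) ≡ e
    es-fromℕ = insertAt-lookup (edgesᵂ w) (fromℕ k) e
    walk-edge≢e : ∀ j → edgesᵂ w j ≢ e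
    walk-edge≢e j = proj₂ (edgesᵂ-satisfy w j)
    es-injective : Injective _≡_ _≡_ es
    es-injective {i} {i′} eq with inject₁-or-fromℕ i | inject₁-or-fromℕ i′
    ... | inj₁ (j , refl) | inj₁ (j′ , refl) =
      cong inject₁ (edgesᵂ-injective w simple (trans (sym (es-inject₁ j)) (trans eq (es-inject₁ j′))))
    ... | inj₁ (j , refl) | inj₂ refl =
      contradiction (trans (sym (es-inject₁ j)) (trans eq es-fromℕ)) (walk-edge≢e j)
    ... | inj₂ refl | inj₁ (j′ , refl) =
      contradiction (trans (sym (es-inject₁ j′)) (trans (sym eq) es-fromℕ)) (walk-edge≢e j′)
    ... | inj₂ refl | inj₂ refl = refl
    es∈S : ∀ i → es i ∈ S
    es∈S i with inject₁-or-fromℕ i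
    ... | inj₁ (j , refl) = subst (_∈ S) (sym (es-inject₁ j)) (proj₁ (edgesᵂ-satisfy w j))
    ... | inj₂ refl = subst (_∈ S) (sym es-fromℕ) e∈S
    es-joins : ∀ i → Joins G (es i) (verticesᵂ w i) (verticesᵂ w (sucMod i))
    es-joins i with inject₁-or-fromℕ i
    ... | inj₁ (j , refl) rewrite es-inject₁ j | sucMod-inject₁ j = edgesᵂ-joins w j
    ... | inj₂ refl rewrite es-fromℕ | sucMod-fromℕ k | verticesᵂ-first w | verticesᵂ-last w = inj₂ refl

  spans-without⇒cycle : ∀ {S e} → e ∈ S → Spans ((_∈ S) ∩ (_≢ e)) e → HasCycle G S
  spans-without⇒cycle e∈S w = let w′ , simple = loop-erase w in simple-spans⇒cycle e∈S w′ simple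

module CycleMatroid {n m : ℕ} (G : Graph n m) where

  open import Data.Nat using (zero; suc; _≤_; _<_; s≤s⁻¹)
  open import Data.Nat.Properties using (≤-trans; ≤-refl; <-≤-trans; n≮0)
  open import Data.Fin.Subset hiding (_∩_)
  open import Data.Fin.Subset.Properties
  open import Data.Fin.Properties using (any?) renaming (_≟_ to _≟ᶠ_)
  open import Data.Product using (Σ-syntax; _×_; _,_; proj₁)
  open import Data.Sum using (inj₁; inj₂)
  open import Relation.Binary.PropositionalEquality
  open import Relation.Nullary using (yes; no; contradiction)
  open import Function using (_∘_)
  open import Relation.Unary using (_∩_)
  open Subsets
  open Walks G
  open Cycles G

  infix 4 _⊆cl_

  _⊆cl_ : Subset m → Subset m → Set
  J ⊆cl F = ∀ {h} → h ∈ J → Spans (_∈ F) h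

  Spanning : Subset m → Set
  Spanning B = ∀ g → Spans (_∈ B) g

  ⊆cl-trans : ∀ {J F F′} → J ⊆cl F → F ⊆cl F′ → J ⊆cl F′
  ⊆cl-trans J⊆clF F⊆clF′ h∈J = bindᵂ (J⊆clF h∈J) F⊆clF′

  Acyclic-anti : ∀ {S T} → S ⊆ T → Acyclic G T → Acyclic G S
  Acyclic-anti S⊆T T-acyclic = T-acyclic ∘ HasCycle-mono S⊆T

  spanning⇒maximal : ∀ {B} → Spanning B → ∀ g → g ∉ B → HasCycle G (⁅ g ⁆ ∪ B)
  spanning⇒maximal B-spanning g g∉B = spans-without⇒cycle (x∈p∪q⁺ (inj₁ (x∈⁅x⁆ g)))
    (mapᵂ (λ h∈B → x∈p∪q⁺ (inj₂ h∈B) , λ { refl → g∉B h∈B }) (B-spanning g))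

  base⇒spanning : ∀ {B} → IsBase G B → Spanning B
  base⇒spanning {B} (B-acyclic , B-maximal) g with g ∈? B
  ... | yes g∈B = spans-self g∈B
  ... | no g∉B with cycle-avoids∨spans g (B-maximal g g∉B)
  ...   | inj₁ cycle = contradiction
            (HasCycle-mono (λ h∈ → x∈⁅y⁆∪p∧x≢y⇒x∈p (p─q⊆p _ _ h∈) (x∈p-y⇒x≢y h∈)) cycle) B-acyclic
  ...   | inj₂ walk = mapᵂ (λ (h∈ , h≢g) → x∈⁅y⁆∪p∧x≢y⇒x∈p h∈ h≢g) walk

  base-exchange : ∀ {B e f} → IsBase G B → f ∉ B → e ∈ B →
    Spans ((_∈ ⁅ f ⁆ ∪ B) ∩ (_≢ e)) e → IsBase G (⁅ f ⁆ ∪ (B - e))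
  base-exchange {B} {e} {f} B-base@(B-acyclic , _) f∉B e∈B e-spanned =
    B′-acyclic , spanning⇒maximal B′-spanning
    where
    B′ = ⁅ f ⁆ ∪ (B - e)
    f∈B′ : f ∈ B′
    f∈B′ = x∈p∪q⁺ (inj₁ (x∈⁅x⁆ f))
    into-B′ : ∀ {h} → h ∈ B → h ≢ e → h ∈ B′
    into-B′ h∈B h≢e = q⊆p∪q ⁅ f ⁆ (B - e) (x∈p∧x≢y⇒x∈p-y h∈B h≢e)
    from-B′ : ∀ {h} → h ∈ B′ → h ≢ f → h ∈ B × h ≢ e
    from-B′ h∈B′ h≢f = let h∈B-e = x∈⁅y⁆∪p∧x≢y⇒x∈p h∈B′ h≢f in p─q⊆p B ⁅ e ⁆ h∈B-e , x∈p-y⇒x≢y h∈B-e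
    B⊆clB′ : B ⊆cl B′
    B⊆clB′ {h} h∈B with h ≟ᶠ e
    ... | yes refl = mapᵂ reroute e-spanned
      where
      reroute : ∀ {h} → ((_∈ ⁅ f ⁆ ∪ B) ∩ (_≢ e)) h → h ∈ B′
      reroute {h} (h∈ , h≢e) with h ≟ᶠ f
      ... | yes refl = f∈B′
      ... | no h≢f = into-B′ (x∈⁅y⁆∪p∧x≢y⇒x∈p h∈ h≢f) h≢e
    ... | no h≢e = spans-self (into-B′ h∈B h≢e)
    B′-spanning : Spanning B′
    B′-spanning g = bindᵂ (base⇒spanning B-base g) B⊆clB′
    B′-acyclic : Acyclic G B′
    B′-acyclic cycle with cycle-avoids∨spans f cycle
    ... | inj₁ cycle′ =
          B-acyclic (HasCycle-mono (λ h∈ → proj₁ (from-B′ (p─q⊆p B′ ⁅ f ⁆ h∈) (x∈p-y⇒x≢y h∈))) cycle′)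
    ... | inj₂ f-spanned = B-acyclic (spans-without⇒cycle e∈B (bindᵂ e-spanned reroute))
      where
      reroute : ∀ {h} → ((_∈ ⁅ f ⁆ ∪ B) ∩ (_≢ e)) h → Spans ((_∈ B) ∩ (_≢ e)) h
      reroute {h} (h∈ , h≢e) with h ≟ᶠ f
      ... | yes refl = mapᵂ (λ (h∈B′ , h≢f) → from-B′ h∈B′ h≢f) f-spanned
      ... | no h≢f = spans-self (x∈⁅y⁆∪p∧x≢y⇒x∈p h∈ h≢f , h≢e)

  module _ {J} (J-acyclic : Acyclic G J) where

    exchange-into : ∀ {F g} → J ⊆cl F → g ∈ J → g ∉ F →
      Σ[ F′ ∈ Subset m ] J ⊆cl F′ × ∣ F′ ∣ ≤ ∣ F ∣ × ∣ J ─ F′ ∣ < ∣ J ─ F ∣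
    exchange-into {F} {g} J⊆clF g∈J g∉F with loop-erase (J⊆clF g∈J)
    ... | w , simple with within-or-first-exit (_∈? J) w simple
    ... | inj₁ w-in-J = contradiction
          (spans-without⇒cycle g∈J (mapᵂ (λ (h∈F , h∈J) → h∈J , λ { refl → g∉F h∈F }) w-in-J)) J-acyclic
    ... | inj₂ (f , _ , _ , f∈F , f∉J , f-joins , before , after) =
          F′ , ⊆cl-trans J⊆clF F⊆clF′ , ∣F′∣≤∣F∣ , ∣J─F′∣<∣J─F∣
      where
      F′ = ⁅ g ⁆ ∪ (F - f)
      g∈F′ : g ∈ F′
      g∈F′ = x∈p∪q⁺ (inj₁ (x∈⁅x⁆ g))
      into-F′ : ∀ {h} → h ∈ F → h ≢ f → h ∈ F′
      into-F′ h∈F h≢f = q⊆p∪q ⁅ g ⁆ (F - f) (x∈p∧x≢y⇒x∈p-y h∈F h≢f)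
      -- f is bypassed through g: back along the walk to one end of g, across g, back from the other
      f-spanned : Spans (_∈ F′) f
      f-spanned = walk⇒spans f-joins
        (reverseᵂ (mapᵂ (λ (h∈F , h∈J) → into-F′ h∈F λ { refl → f∉J h∈J }) before)
          ++ᵂ spans-self g∈F′
          ++ᵂ reverseᵂ (mapᵂ (λ (h∈F , h≢f) → into-F′ h∈F h≢f) after))
      F⊆clF′ : F ⊆cl F′
      F⊆clF′ {h} h∈F with h ≟ᶠ f
      ... | yes refl = f-spanned
      ... | no h≢f = spans-self (into-F′ h∈F h≢f)
      ∣F′∣≤∣F∣ : ∣ F′ ∣ ≤ ∣ F ∣
      ∣F′∣≤∣F∣ = ≤-trans (∣⁅x⁆∪p∣≤1+∣p∣ g (F - f)) (x∈p⇒∣p-x∣<∣p∣ f∈F)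
      J─F′⊆J─F : J ─ F′ ⊆ J ─ F
      J─F′⊆J─F h∈ = x∈p∧x∉q⇒x∈p─q (p─q⊆p J F′ h∈)
        (λ h∈F → x∈p─q⇒x∉q h∈ (into-F′ h∈F λ { refl → f∉J (p─q⊆p J F′ h∈) }))
      ∣J─F′∣<∣J─F∣ : ∣ J ─ F′ ∣ < ∣ J ─ F ∣
      ∣J─F′∣<∣J─F∣ = p⊂q⇒∣p∣<∣q∣ (J─F′⊆J─F , g , x∈p∧x∉q⇒x∈p─q g∈J g∉F , λ g∈ → x∈p─q⇒x∉q g∈ g∈F′)

    ∣acyclic∣≤∣spanning∣ : ∀ {F} → J ⊆cl F → ∣ J ∣ ≤ ∣ F ∣
    ∣acyclic∣≤∣spanning∣ = by-induction-on-∣J─F∣ _ ≤-refl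
      where
      by-induction-on-∣J─F∣ : ∀ d {F} → ∣ J ─ F ∣ ≤ d → J ⊆cl F → ∣ J ∣ ≤ ∣ F ∣
      by-induction-on-∣J─F∣ d {F} ≤d J⊆clF with any? (λ g → g ∈? J ─ F)
      ... | no ∄g = p⊆q⇒∣p∣≤∣q∣ J⊆F
        where
        J⊆F : J ⊆ F
        J⊆F {g} g∈J with g ∈? F
        ... | yes g∈F = g∈F
        ... | no g∉F = contradiction (g , x∈p∧x∉q⇒x∈p─q g∈J g∉F) ∄g
      ... | yes (g , g∈J─F) with exchange-into J⊆clF (p─q⊆p J F g∈J─F) (x∈p─q⇒x∉q g∈J─F) | d
      ... | F′ , J⊆clF′ , ∣F′∣≤∣F∣ , smaller | zero = contradiction (<-≤-trans smaller ≤d) n≮0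
      ... | F′ , J⊆clF′ , ∣F′∣≤∣F∣ , smaller | suc d′ =
            ≤-trans (by-induction-on-∣J─F∣ d′ (s≤s⁻¹ (<-≤-trans smaller ≤d)) J⊆clF′) ∣F′∣≤∣F∣

module BondMatroid {n m : ℕ} (G : Graph n m) where

  open import Data.Nat using (zero; suc; _+_; _≤_; _<_)
  open import Data.Nat.Properties
  open import Data.Fin using (Fin)
  open import Data.Fin.Subset
  open import Data.Fin.Subset.Properties
  open import Data.Fin.Properties using (any?) renaming (_≟_ to _≟ᶠ_)
  open import Data.Product using (Σ-syntax; _×_; _,_; proj₁; proj₂)
  open import Data.Sum using (inj₁; inj₂)
  open import Relation.Binary.PropositionalEquality
  open import Relation.Nullary using (¬_; Dec; yes; no; contradiction; ¬?)
  open import Relation.Nullary.Decidable using (_×-dec_)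
  open import Function using (id)
  open Subsets
  open Walks G
  open Cycles G
  open CycleMatroid G

  CoIndep-anti : ∀ {I J} → J ⊆ I → CoIndep G I → CoIndep G J
  CoIndep-anti J⊆I (B , B-base , I∩B=∅) = B , B-base , λ e e∈J → I∩B=∅ e (J⊆I e∈J)

  coIndep-insert : ∀ {B I e} → IsBase G B → e ∉ B → (∀ h → h ∈ I → h ∉ B) → CoIndep G (⁅ e ⁆ ∪ I)
  coIndep-insert {B} {I} {e} B-base e∉B I∩B=∅ = B , B-base , disjoint
    where
    disjoint : ∀ h → h ∈ ⁅ e ⁆ ∪ I → h ∉ B
    disjoint h h∈ with x∈p∪q⁻ ⁅ e ⁆ I h∈
    ... | inj₁ h∈⁅e⁆ = subst (_∉ B) (sym (x∈⁅y⁆⇒x≡y e h∈⁅e⁆)) e∉B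
    ... | inj₂ h∈I = I∩B=∅ h h∈I

  module _ {I K Bᴵ Bᴷ} (Bᴵ-base : IsBase G Bᴵ) (I∩Bᴵ=∅ : ∀ e → e ∈ I → e ∉ Bᴵ)
           (Bᴷ-base : IsBase G Bᴷ) (K∩Bᴷ=∅ : ∀ e → e ∈ K → e ∉ Bᴷ)
           (stuck : ∀ e → e ∈ K → e ∉ I → ¬ CoIndep G (⁅ e ⁆ ∪ I)) where

    K─I⊆Bᴵ : K ─ I ⊆ Bᴵ
    K─I⊆Bᴵ {e} e∈K─I with e ∈? Bᴵ
    ... | yes e∈Bᴵ = e∈Bᴵ
    ... | no e∉Bᴵ = contradiction (coIndep-insert Bᴵ-base e∉Bᴵ I∩Bᴵ=∅)
                      (stuck e (p─q⊆p K I e∈K─I) (x∈p─q⇒x∉q e∈K─I))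

    -- An edge of Bᴷ ─ I outside Bᴵ closes a cycle with Bᴵ; that cycle cannot meet K,
    -- for exchanging the edge it meets would give a base avoiding I plus that edge.
    Bᴷ─I⊆clBᴵ─K : Bᴷ ─ I ⊆cl Bᴵ ─ K
    Bᴷ─I⊆clBᴵ─K {f} f∈Bᴷ─I with f ∈? Bᴵ
    ... | yes f∈Bᴵ = spans-self (x∈p∧x∉q⇒x∈p─q f∈Bᴵ (λ f∈K → K∩Bᴷ=∅ f f∈K f∈Bᴷ))
      where f∈Bᴷ = p─q⊆p Bᴷ I f∈Bᴷ─I
    ... | no f∉Bᴵ with cycle-meets∨avoids K (proj₂ Bᴵ-base f f∉Bᴵ)
    ...   | inj₁ (e , e∈ , e∈K , e-spanned) = contradiction
              (coIndep-insert (base-exchange Bᴵ-base f∉Bᴵ e∈Bᴵ e-spanned) e∉Bᴵ′ I∩Bᴵ′=∅)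
              (stuck e e∈K e∉I)
      where
      f∉K : f ∉ K
      f∉K f∈K = K∩Bᴷ=∅ f f∈K (p─q⊆p Bᴷ I f∈Bᴷ─I)
      e≢f : e ≢ f
      e≢f refl = f∉K e∈K
      e∈Bᴵ : e ∈ Bᴵ
      e∈Bᴵ = x∈⁅y⁆∪p∧x≢y⇒x∈p e∈ e≢f
      e∉I : e ∉ I
      e∉I e∈I = I∩Bᴵ=∅ e e∈I e∈Bᴵ
      e∉Bᴵ′ : e ∉ ⁅ f ⁆ ∪ (Bᴵ - e)
      e∉Bᴵ′ e∈ = x∈p-y⇒x≢y (x∈⁅y⁆∪p∧x≢y⇒x∈p e∈ e≢f) refl
      I∩Bᴵ′=∅ : ∀ h → h ∈ I → h ∉ ⁅ f ⁆ ∪ (Bᴵ - e)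
      I∩Bᴵ′=∅ h h∈I h∈ with h ≟ᶠ f
      ... | yes refl = x∈p─q⇒x∉q f∈Bᴷ─I h∈I
      ... | no h≢f = I∩Bᴵ=∅ h h∈I (p─q⊆p Bᴵ ⁅ e ⁆ (x∈⁅y⁆∪p∧x≢y⇒x∈p h∈ h≢f))
    ...   | inj₂ cycle with cycle-avoids∨spans f cycle
    ...     | inj₁ cycle′ = contradiction
                (HasCycle-mono
                  (λ h∈ → p─q⊆p Bᴵ K (x∈[⁅y⁆∪p]─q∧x≢y⇒x∈p─q (p─q⊆p _ ⁅ f ⁆ h∈) (x∈p-y⇒x≢y h∈))) cycle′)
                (proj₁ Bᴵ-base)
    ...     | inj₂ f-spanned = mapᵂ (λ (h∈ , h≢f) → x∈[⁅y⁆∪p]─q∧x≢y⇒x∈p─q h∈ h≢f) f-spanned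

    stuck⇒∣K∣≤∣I∣ : ∣ K ∣ ≤ ∣ I ∣
    stuck⇒∣K∣≤∣I∣ = ∣p─q∣≤∣q─p∣⇒∣p∣≤∣q∣ K I (+-cancelˡ-≤ ∣ Bᴵ ─ K ∣ _ _ (begin
      ∣ Bᴵ ─ K ∣ + ∣ K ─ I ∣         ≡⟨ Empty[p∩q]⇒∣p∪q∣≡∣p∣+∣q∣ (Bᴵ ─ K) (K ─ I) disjoint ⟨
      ∣ (Bᴵ ─ K) ∪ (K ─ I) ∣         ≤⟨ p⊆q⇒∣p∣≤∣q∣ [Bᴵ─K]∪[K─I]⊆Bᴵ ⟩
      ∣ Bᴵ ∣                         ≤⟨ ∣acyclic∣≤∣spanning∣ (proj₁ Bᴵ-base) (λ _ → base⇒spanning Bᴷ-base _) ⟩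
      ∣ Bᴷ ∣                         ≤⟨ p⊆q⇒∣p∣≤∣q∣ Bᴷ⊆[Bᴷ─I]∪[I─K] ⟩
      ∣ (Bᴷ ─ I) ∪ (I ─ K) ∣         ≤⟨ ∣p∪q∣≤∣p∣+∣q∣ (Bᴷ ─ I) (I ─ K) ⟩
      ∣ Bᴷ ─ I ∣ + ∣ I ─ K ∣         ≤⟨ +-monoˡ-≤ ∣ I ─ K ∣ ∣Bᴷ─I∣≤∣Bᴵ─K∣ ⟩
      ∣ Bᴵ ─ K ∣ + ∣ I ─ K ∣         ∎))
      where
      open ≤-Reasoning
      ∣Bᴷ─I∣≤∣Bᴵ─K∣ : ∣ Bᴷ ─ I ∣ ≤ ∣ Bᴵ ─ K ∣
      ∣Bᴷ─I∣≤∣Bᴵ─K∣ = ∣acyclic∣≤∣spanning∣ (Acyclic-anti (p─q⊆p Bᴷ I) (proj₁ Bᴷ-base)) Bᴷ─I⊆clBᴵ─K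
      disjoint : Empty ((Bᴵ ─ K) ∩ (K ─ I))
      disjoint (e , e∈) = let e∈Bᴵ─K , e∈K─I = x∈p∩q⁻ (Bᴵ ─ K) (K ─ I) e∈ in
        x∈p─q⇒x∉q e∈Bᴵ─K (p─q⊆p K I e∈K─I)
      [Bᴵ─K]∪[K─I]⊆Bᴵ : (Bᴵ ─ K) ∪ (K ─ I) ⊆ Bᴵ
      [Bᴵ─K]∪[K─I]⊆Bᴵ e∈ with x∈p∪q⁻ (Bᴵ ─ K) (K ─ I) e∈
      ... | inj₁ e∈Bᴵ─K = p─q⊆p Bᴵ K e∈Bᴵ─K
      ... | inj₂ e∈K─I = K─I⊆Bᴵ e∈K─I
      Bᴷ⊆[Bᴷ─I]∪[I─K] : Bᴷ ⊆ (Bᴷ ─ I) ∪ (I ─ K)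
      Bᴷ⊆[Bᴷ─I]∪[I─K] {e} e∈Bᴷ with e ∈? I
      ... | yes e∈I = x∈p∪q⁺ (inj₂ (x∈p∧x∉q⇒x∈p─q e∈I (λ e∈K → K∩Bᴷ=∅ e e∈K e∈Bᴷ)))
      ... | no e∉I = x∈p∪q⁺ (inj₁ (x∈p∧x∉q⇒x∈p─q e∈Bᴷ e∉I))

  module BondRank (r* : Subset m → ℕ) (r*-isRank : ∀ X → IsBondRank G X (r* X)) where

    r*-maximal : ∀ X {I} → I ⊆ X → CoIndep G I → ∣ I ∣ ≤ r* X
    r*-maximal X = proj₂ (r*-isRank X) _

    -- Coindependence itself is not evidently decidable; the given rank function decides it.
    coIndep? : ∀ X → Dec (CoIndep G X)
    coIndep? X with r* X ≟ ∣ X ∣ | proj₁ (r*-isRank X)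
    ... | yes r*X≡∣X∣ | I , I⊆X , I-coindep , ∣I∣≡r*X =
          yes (CoIndep-anti (p⊆q⇒∣q∣≤∣p∣⇒q⊆p I⊆X (≤-reflexive (trans (sym r*X≡∣X∣) (sym ∣I∣≡r*X))))
                            I-coindep)
    ... | no r*X≢∣X∣ | I , I⊆X , _ , ∣I∣≡r*X =
          no λ X-coindep → r*X≢∣X∣
               (≤-antisym (subst (_≤ ∣ X ∣) ∣I∣≡r*X (p⊆q⇒∣p∣≤∣q∣ I⊆X)) (r*-maximal X id X-coindep))

    augment : ∀ {I K} → CoIndep G I → CoIndep G K → ∣ I ∣ < ∣ K ∣ →
      Σ[ e ∈ Fin m ] e ∈ K × e ∉ I × CoIndep G (⁅ e ⁆ ∪ I)
    augment {I} {K} (Bᴵ , Bᴵ-base , I∩Bᴵ=∅) (Bᴷ , Bᴷ-base , K∩Bᴷ=∅) ∣I∣<∣K∣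
      with any? (λ e → e ∈? K ×-dec ¬? (e ∈? I) ×-dec coIndep? (⁅ e ⁆ ∪ I))
    ... | yes found = found
    ... | no ∄ = contradiction
          (stuck⇒∣K∣≤∣I∣ Bᴵ-base I∩Bᴵ=∅ Bᴷ-base K∩Bᴷ=∅ (λ e e∈K e∉I coindep → ∄ (e , e∈K , e∉I , coindep)))
          (<⇒≱ ∣I∣<∣K∣)

    extend : ∀ d {Z J K} → ∣ K ∣ ≤ d + ∣ J ∣ → J ⊆ Z → K ⊆ Z → CoIndep G J → CoIndep G K →
      Σ[ J′ ∈ Subset m ] J ⊆ J′ × J′ ⊆ Z × CoIndep G J′ × ∣ K ∣ ≤ ∣ J′ ∣
    extend zero {J = J} ∣K∣≤∣J∣ J⊆Z _ J-coindep _ = J , id , J⊆Z , J-coindep , ∣K∣≤∣J∣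
    extend (suc d) {Z} {J} {K} ∣K∣≤1+d+∣J∣ J⊆Z K⊆Z J-coindep K-coindep with ∣ K ∣ ≤? ∣ J ∣
    ... | yes ∣K∣≤∣J∣ = J , id , J⊆Z , J-coindep , ∣K∣≤∣J∣
    ... | no ∣K∣≰∣J∣ with augment J-coindep K-coindep (≰⇒> ∣K∣≰∣J∣)
    ... | e , e∈K , e∉J , J+e-coindep with extend d ∣K∣≤d+∣J+e∣ J+e⊆Z K⊆Z J+e-coindep K-coindep
      where
      ∣K∣≤d+∣J+e∣ : ∣ K ∣ ≤ d + ∣ ⁅ e ⁆ ∪ J ∣
      ∣K∣≤d+∣J+e∣ = subst (∣ K ∣ ≤_)
        (trans (sym (+-suc d ∣ J ∣)) (cong (d +_) (sym (x∉p⇒∣⁅x⁆∪p∣≡1+∣p∣ e∉J)))) ∣K∣≤1+d+∣J∣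
      J+e⊆Z : ⁅ e ⁆ ∪ J ⊆ Z
      J+e⊆Z h∈ with x∈p∪q⁻ ⁅ e ⁆ J h∈
      ... | inj₁ h∈⁅e⁆ = subst (_∈ Z) (sym (x∈⁅y⁆⇒x≡y e h∈⁅e⁆)) (K⊆Z e∈K)
      ... | inj₂ h∈J = J⊆Z h∈J
    ... | J′ , J+e⊆J′ , rest = J′ , (λ h∈J → J+e⊆J′ (q⊆p∪q ⁅ e ⁆ J h∈J)) , rest

    r*-mono : ∀ {X Y} → X ⊆ Y → r* X ≤ r* Y
    r*-mono {X} {Y} X⊆Y with proj₁ (r*-isRank X)
    ... | I , I⊆X , I-coindep , ∣I∣≡r*X =
          subst (_≤ r* Y) ∣I∣≡r*X (r*-maximal Y (λ h∈I → X⊆Y (I⊆X h∈I)) I-coindep)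

    -- Extend a largest coindependent subset I of X ∩ Y to one of X ∪ Y; its parts in X and in Y
    -- are coindependent, and both contain I.
    r*-submodular : ∀ X Y → r* (X ∪ Y) + r* (X ∩ Y) ≤ r* X + r* Y
    r*-submodular X Y with proj₁ (r*-isRank (X ∩ Y)) | proj₁ (r*-isRank (X ∪ Y))
    ... | I , I⊆X∩Y , I-coindep , ∣I∣≡ | K , K⊆X∪Y , K-coindep , ∣K∣≡
      with extend ∣ K ∣ (m≤m+n ∣ K ∣ ∣ I ∣) (λ h∈I → p⊆p∪q Y (p∩q⊆p X Y (I⊆X∩Y h∈I))) K⊆X∪Y
                  I-coindep K-coindep
    ... | J , I⊆J , J⊆X∪Y , J-coindep , ∣K∣≤∣J∣ = begin
      r* (X ∪ Y) + r* (X ∩ Y)                      ≡⟨ cong₂ _+_ ∣K∣≡ ∣I∣≡ ⟨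
      ∣ K ∣ + ∣ I ∣                                  ≤⟨ +-mono-≤ ∣K∣≤∣JX∪JY∣ (p⊆q⇒∣p∣≤∣q∣ I⊆JX∩JY) ⟩
      ∣ (J ∩ X) ∪ (J ∩ Y) ∣ + ∣ (J ∩ X) ∩ (J ∩ Y) ∣  ≡⟨ ∣p∣+∣q∣≡∣p∪q∣+∣p∩q∣ (J ∩ X) (J ∩ Y) ⟨
      ∣ J ∩ X ∣ + ∣ J ∩ Y ∣                          ≤⟨ +-mono-≤ (∣J∩Z∣≤r*Z X) (∣J∩Z∣≤r*Z Y) ⟩
      r* X + r* Y                                  ∎
      where
      open ≤-Reasoning
      ∣J∩Z∣≤r*Z : ∀ Z → ∣ J ∩ Z ∣ ≤ r* Z
      ∣J∩Z∣≤r*Z Z = r*-maximal Z (p∩q⊆q J Z) (CoIndep-anti (p∩q⊆p J Z) J-coindep)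
      J⊆JX∪JY : J ⊆ (J ∩ X) ∪ (J ∩ Y)
      J⊆JX∪JY h∈J with x∈p∪q⁻ X Y (J⊆X∪Y h∈J)
      ... | inj₁ h∈X = x∈p∪q⁺ (inj₁ (x∈p∩q⁺ (h∈J , h∈X)))
      ... | inj₂ h∈Y = x∈p∪q⁺ (inj₂ (x∈p∩q⁺ (h∈J , h∈Y)))
      I⊆JX∩JY : I ⊆ (J ∩ X) ∩ (J ∩ Y)
      I⊆JX∩JY h∈I = let h∈X , h∈Y = x∈p∩q⁻ X Y (I⊆X∩Y h∈I) in
        x∈p∩q⁺ (x∈p∩q⁺ (I⊆J h∈I , h∈X) , x∈p∩q⁺ (I⊆J h∈I , h∈Y))
      ∣K∣≤∣JX∪JY∣ : ∣ K ∣ ≤ ∣ (J ∩ X) ∪ (J ∩ Y) ∣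
      ∣K∣≤∣JX∪JY∣ = ≤-trans ∣K∣≤∣J∣ (p⊆q⇒∣p∣≤∣q∣ J⊆JX∪JY)

module Cuts {n m : ℕ} (G : Graph n m) where

  open import Data.Nat using (_+_; _≤_)
  open import Data.Nat.Properties using (≤-trans; +-mono-≤)
  open import Data.Bool using (true; _∨_)
  open import Data.Fin.Subset
  open import Data.Fin.Subset.Properties using (_∈?_; x∈p∪q⁻; x∈p∪q⁺; p∩q⊆p; p∩q⊆q; x∈p∩q⁺)
  open import Data.Vec.Properties using (lookup∘tabulate; []=⇒lookup; lookup⇒[]=)
  open import Data.Product using (_,_; proj₁; proj₂)
  open import Data.Sum as Sum using (_⊎_; inj₁; inj₂; [_,_]′)
  open import Relation.Binary.PropositionalEquality
  open import Relation.Nullary using (Dec; yes; no; contradiction)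
  open import Relation.Nullary.Decidable using (⌊_⌋)

  ⌊a⌋∨⌊b⌋≡true⇒a⊎b : ∀ {A B : Set} (a? : Dec A) (b? : Dec B) → ⌊ a? ⌋ ∨ ⌊ b? ⌋ ≡ true → A ⊎ B
  ⌊a⌋∨⌊b⌋≡true⇒a⊎b (yes a) _ _ = inj₁ a
  ⌊a⌋∨⌊b⌋≡true⇒a⊎b (no _) (yes b) _ = inj₂ b

  a⊎b⇒⌊a⌋∨⌊b⌋≡true : ∀ {A B : Set} (a? : Dec A) (b? : Dec B) → A ⊎ B → ⌊ a? ⌋ ∨ ⌊ b? ⌋ ≡ true
  a⊎b⇒⌊a⌋∨⌊b⌋≡true (yes _) _ _ = refl
  a⊎b⇒⌊a⌋∨⌊b⌋≡true (no _) (yes _) _ = refl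
  a⊎b⇒⌊a⌋∨⌊b⌋≡true (no ¬a) (no ¬b) a⊎b = contradiction a⊎b [ ¬a , ¬b ]′

  ∈δ⁻ : ∀ {A e} → e ∈ δ G A → proj₁ (G e) ∈ A ⊎ proj₂ (G e) ∈ A
  ∈δ⁻ {A} {e} e∈δA = ⌊a⌋∨⌊b⌋≡true⇒a⊎b (proj₁ (G e) ∈? A) (proj₂ (G e) ∈? A)
    (trans (sym (lookup∘tabulate _ e)) ([]=⇒lookup e∈δA))

  ∈δ⁺ : ∀ {A e} → proj₁ (G e) ∈ A ⊎ proj₂ (G e) ∈ A → e ∈ δ G A
  ∈δ⁺ {A} {e} end∈A = lookup⇒[]= e _
    (trans (lookup∘tabulate _ e) (a⊎b⇒⌊a⌋∨⌊b⌋≡true (proj₁ (G e) ∈? A) (proj₂ (G e) ∈? A) end∈A))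

  δ-mono : ∀ {A B} → A ⊆ B → δ G A ⊆ δ G B
  δ-mono A⊆B e∈δA = ∈δ⁺ (Sum.map A⊆B A⊆B (∈δ⁻ e∈δA))

  δ-∪ : ∀ A B → δ G (A ∪ B) ⊆ δ G A ∪ δ G B
  δ-∪ A B {e} e∈ = [ via inj₁ , via inj₂ ]′ (∈δ⁻ e∈)
    where
    via : ∀ {v} → (∀ {X} → v ∈ X → proj₁ (G e) ∈ X ⊎ proj₂ (G e) ∈ X) → v ∈ A ∪ B → e ∈ δ G A ∪ δ G B
    via end v∈A∪B = [ (λ v∈A → x∈p∪q⁺ (inj₁ (∈δ⁺ (end v∈A)))) , (λ v∈B → x∈p∪q⁺ (inj₂ (∈δ⁺ (end v∈B)))) ]′
                      (x∈p∪q⁻ A B v∈A∪B)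

  δ-∩ : ∀ A B → δ G (A ∩ B) ⊆ δ G A ∩ δ G B
  δ-∩ A B e∈ = x∈p∩q⁺ (δ-mono (p∩q⊆p A B) e∈ , δ-mono (p∩q⊆q A B) e∈)

  module _ (r* : Subset m → ℕ) (r*-isRank : ∀ X → IsBondRank G X (r* X)) where

    open BondMatroid.BondRank G r* r*-isRank

    r*∘δ-submodular : ∀ A B → r* (δ G (A ∪ B)) + r* (δ G (A ∩ B)) ≤ r* (δ G A) + r* (δ G B)
    r*∘δ-submodular A B = ≤-trans
      (+-mono-≤ (r*-mono (δ-∪ A B)) (r*-mono (δ-∩ A B)))
      (r*-submodular (δ G A) (δ G B))

open import Data.Integer using (ℤ; +_; _-_; _+_; _≤_; -_; +≤+)
open import Data.Integer.Properties using (pos-+; +-monoˡ-≤)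
open import Data.Integer.Tactic.RingSolver using (solve-∀)
open import Data.Fin.Subset using (Subset; _∪_; _∩_; _⊆_)
open import Data.Product using (_×_; _,_)
open import Relation.Binary.PropositionalEquality using (_≡_; sym; subst₂)
import Data.Nat as ℕ

pair-shift : ∀ (x y k : ℤ) → (x - k) + (y - k) ≡ (x + y) + (- k - k)
pair-shift = solve-∀

shift-submodular : ∀ {n} (g : Subset n → ℕ) k → (∀ A B → g (A ∪ B) ℕ.+ g (A ∩ B) ℕ.≤ g A ℕ.+ g B) →
  ∀ A B → (+ g (A ∪ B) - k) + (+ g (A ∩ B) - k) ≤ (+ g A - k) + (+ g B - k)
shift-submodular g k g-submodular A B =
  subst₂ _≤_ (sym (pair-shift (+ g (A ∪ B)) (+ g (A ∩ B)) k)) (sym (pair-shift (+ g A) (+ g B) k))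
    (+-monoˡ-≤ (- k - k)
      (subst₂ _≤_ (pos-+ (g (A ∪ B)) (g (A ∩ B))) (pos-+ (g A) (g B)) (+≤+ (g-submodular A B))))

lemma2p1 : ∀ {n m} (G : Graph n m) (rstar : Subset m → ℕ) →
    (∀ X → IsBondRank G X (rstar X)) →
    let f : Subset n → ℤ
        f A = + rstar (δ G A) - + 1
    in (∀ A B → f (A ∪ B) + f (A ∩ B) ≤ f A + f B) ×
       (∀ A B → A ⊆ B → f A ≤ f B)
lemma2p1 G r* r*-isRank =
  shift-submodular (λ A → r* (δ G A)) (+ 1) (r*∘δ-submodular r* r*-isRank) ,
  (λ A B A⊆B → +-monoˡ-≤ (- + 1) (+≤+ (r*-mono (δ-mono A⊆B))))
  where
  open Cuts G
  open BondMatroid.BondRank G r* r*-isRank
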